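{- Let $r$ and $l$ be positive integers with $r \geq 2$. Then there exists a graph $\mathcal{F}$ with vertex set $[lr(2r-1)]$ such that $\chi\left(\mathrm{KG}^r(\mathcal{F}_{r\text{ -stable}})\right) = 1$ and $\left\lceil \frac{\mathrm{cd}^r(\mathcal{F})}{r-1} \right\rceil \geq 2$.
   Context: $[n]=\{1,\dots,n\}$. A hypergraph $\mathcal{H}$ on vertex set $V$ is a family $E(\mathcal{H})$ of nonempty subsets of $V$ (hyperedges); a graph is a hypergraph all of whose hyperedges have size 2. A set $S \subseteq [n]$ is $r$-stable if any two distinct $i,j \in S$ satisfy $r \leq |i-j| \leq n-r$. For a hypergraph $\mathcal{H}$ on $[n]$, $\mathcal{H}_{r\text{ -stable}}$ denotes the hypergraph on $[n]$ whose hyperedges are the $r$-stable hyperedges of $\mathcal{H}$. For a hypergraph $\mathcal{F}$ and $r\ge 2$, the general Kneser hypergraph $\mathrm{KG}^r(\mathcal{F})$ has vertex set $E(\mathcal{F})$, and its hyperedges are the sets of $r$ pairwise disjoint hyperedges of $\mathcal{F}$. The chromatic number $\chi$ of a hypergraph is the least number of colors in a vertex coloring with no monochromatic hyperedge (it is $0$ when the vertex set is empty). The $r$-colorability defect $\mathrm{cd}^r(\mathcal{H})$ is the minimum size of a set $S \subseteq V(\mathcal{H})$ such that the induced subhypergraph on $V(\mathcal{H})\setminus S$ (whose hyperedges are the hyperedges of $\mathcal{H}$ contained in $V(\mathcal{H})\setminus S$) admits a vertex coloring with at most $r$ colors having no monochromatic hyperedge. -}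

module Defs where

open import Data.Nat using (ℕ; zero; suc; _+_; _*_; _∸_; _≤_; _<_)
open import Data.Nat.DivMod using (_/_)
open import Data.Fin using (Fin; toℕ)
open import Data.Fin.Subset using (Subset; _∉_; ∣_∣)
open import Data.Product using (Σ; _×_; _,_; proj₁; proj₂; ∃)
open import Relation.Binary.PropositionalEquality using (_≡_; _≢_)
open import Relation.Nullary using (¬_)

-- Graphs on the vertex set [n], represented as Fin n
-- (vertex k of Fin n stands for k+1 ∈ [n]).
-- A graph is a family of 2-element subsets; we present it by a
-- symmetric irreflexive adjacency relation, the hyperedge {i,j}
-- being present iff Adj i j.

record Graph (n : ℕ) : Set₁ where
  field
    Adj   : Fin n → Fin n → Set
    sym   : ∀ {i j} → Adj i j → Adj j i
    irrefl : ∀ {i} → ¬ Adj i i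

open Graph public

Edge : ∀ {n} → Graph n → Set
Edge {n} F = Σ (Fin n) λ i → Σ (Fin n) λ j → (toℕ i < toℕ j) × Adj F i j

lo hi : ∀ {n} (F : Graph n) → Edge F → Fin n
lo F e = proj₁ e
hi F e = proj₁ (proj₂ e)

Stable : ∀ {n} {F : Graph n} → ℕ → Edge F → Set
Stable {n} {F} r e = (r ≤ toℕ (hi F e) ∸ toℕ (lo F e)) × (toℕ (hi F e) ∸ toℕ (lo F e) ≤ n ∸ r)

-- Vertices of KG^r(F_{r-stable}): the r-stable edges of F.
StableEdge : ∀ {n} → Graph n → ℕ → Set
StableEdge F r = Σ (Edge F) (Stable {F = F} r)

edgeOf : ∀ {n} {F : Graph n} {r : ℕ} → StableEdge F r → Edge F
edgeOf = proj₁

Disjoint : ∀ {n} (F : Graph n) → Edge F → Edge F → Set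
Disjoint F e f = (lo F e ≢ lo F f) × (lo F e ≢ hi F f) × (hi F e ≢ lo F f) × (hi F e ≢ hi F f)

-- Hyperedges of KG^r(F_{r-stable}): r pairwise disjoint r-stable edges
-- (pairwise disjointness of nonempty sets forces the r of them to be distinct).
KGEdge : ∀ {n} → Graph n → ℕ → Set
KGEdge F r = Σ (Fin r → StableEdge F r) λ es →
  ∀ a b → a ≢ b → Disjoint F (edgeOf {F = F} {r = r} (es a)) (edgeOf {F = F} {r = r} (es b))

KGProperColouring : ∀ {n} → Graph n → ℕ → ℕ → Set
KGProperColouring F r k =
  Σ (StableEdge F r → Fin k) λ c →
    ∀ (h : KGEdge F r) → ¬ (∀ a b → c (proj₁ h a) ≡ c (proj₁ h b))

KGChromaticNumber : ∀ {n} → Graph n → ℕ → ℕ → Set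
KGChromaticNumber F r k =
  KGProperColouring F r k × (∀ m → m < k → ¬ KGProperColouring F r m)

ColourableOutside : ∀ {n} → Graph n → ℕ → Subset n → Set
ColourableOutside {n} F r S =
  Σ ((i : Fin n) → i ∉ S → Fin r) λ c →
    ∀ i j (i∉S : i ∉ S) (j∉S : j ∉ S) → Adj F i j → c i i∉S ≢ c j j∉S

ColourabilityDefect : ∀ {n} → Graph n → ℕ → ℕ → Set
ColourabilityDefect {n} F r d =
  (Σ (Subset n) λ S → (∣ S ∣ ≡ d) × ColourableOutside F r S) ×
  (∀ (S : Subset n) → ColourableOutside F r S → d ≤ ∣ S ∣)

-- Ceiling division ⌈ m / d ⌉ for d ≥ 1 (value at d = 0 is irrelevant, set to 0).
⌈_/_⌉ : ℕ → ℕ → ℕ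
⌈ m / zero ⌉ = 0
⌈ m / suc d ⌉ = (m + d) / suc d

{-# OPTIONS --safe #-}
-- Put L = lr, R = 2r - 1 and N = LR, and take on ℤ_N the (r-1)-st power of the N-cycle
-- (the band) together with an R-cycle through the corners 0, L, 2L, …, (R-1)L.
-- Band edges join points at cyclic distance < r, so they are never r-stable: the stable
-- edges all lie on the R corners, and r disjoint ones would need 2r > R of them, so
-- KG^r(F_{r-stable}) has no hyperedges and χ = 1.
-- Colouring by residue mod r (note r ∣ N) is proper on the band, and deleting the r even
-- corners breaks the odd cycle, so cd^r(F) ≤ r. Conversely, on an arc kL, …, kL + L of
-- consecutive vertices a proper r-colouring of the band is r-periodic, so the two ends of
-- the arc, which are adjacent corners, get the same colour. Hence a removed set S meets
-- all R arcs; as each vertex lies on at most two of them, 2|S| ≥ R and |S| ≥ r.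
module Submission where

open import Data.Empty using (⊥-elim)
import Data.Fin as Fin
open Fin using (Fin; zero; suc; toℕ; fromℕ<; remQuot; combine)
open import Data.Fin.Properties
  using (toℕ<n; toℕ-fromℕ<; toℕ-injective; fromℕ<-cong; suc-injective; ¬Fin0; any?; all?;
         pigeonhole; injective⇒≤; combine-remQuot; combine-injectiveˡ; combine-injectiveʳ)
open import Data.Fin.Subset
  using (Subset; _∈_; _∉_; ∣_∣; _∪_; ⁅_⁆; inside; outside) renaming (⊥ to ∅)
open import Data.Fin.Subset.Properties
  using (_∈?_; x∈⁅x⁆; p⊆p∪q; q⊆p∪q; ∣⊥∣≡0; ∣⁅x⁆∣≡1)
open import Data.Nat
open import Data.Nat.Properties hiding (suc-injective)
open import Data.Nat.DivMod
open import Data.Nat.Divisibility using (n∣m*n; n∣m*n*o)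
open import Data.Product using (Σ; _×_; _,_; proj₁; proj₂; ∃; swap; uncurry)
open import Data.Sum using (_⊎_; inj₁; inj₂; [_,_])
import Data.Sum as Sum
open import Data.Vec using (_∷_; []; here; there)
open import Function using (_∘_)
open import Function.Definitions using (Injective)
open import Relation.Nullary using (¬_; yes; no; Dec; ¬?; recompute; contradiction)
open import Relation.Binary.PropositionalEquality
  using (_≡_; _≢_; refl; sym; trans; cong; cong₂; subst; subst₂; module ≡-Reasoning)
open import Defs hiding (sym; irrefl)

[m+n]%o≡[m%o+n]%o : ∀ m n o .{{_ : NonZero o}} → (m + n) % o ≡ (m % o + n) % o
[m+n]%o≡[m%o+n]%o m n o = begin
  (m + n) % o                  ≡⟨ %-distribˡ-+ m n o ⟩
  (m % o + n % o) % o          ≡⟨ cong (λ x → (x + n % o) % o) (m%n%n≡m%n m o) ⟨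
  (m % o % o + n % o) % o      ≡⟨ %-distribˡ-+ (m % o) n o ⟨
  (m % o + n) % o              ∎
  where open ≡-Reasoning

[m+n]%o≡m+n∨[m+n]%o+o≡m+n : ∀ m n o .{{_ : NonZero o}} → m < o → n ≤ o →
  (m + n) % o ≡ m + n ⊎ (m + n) % o + o ≡ m + n
[m+n]%o≡m+n∨[m+n]%o+o≡m+n m n o m<o n≤o with m + n <? o
... | yes m+n<o = inj₁ (m<n⇒m%n≡m m+n<o)
... | no  m+n≮o = inj₂ (begin
  (m + n) % o + o        ≡⟨ cong (λ x → x % o + o) y+o≡m+n ⟨
  (y + o) % o + o        ≡⟨ cong (_+ o) ([m+n]%n≡m%n y o) ⟩
  y % o + o              ≡⟨ cong (_+ o) (m<n⇒m%n≡m y<o) ⟩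
  y + o                  ≡⟨ y+o≡m+n ⟩
  m + n                  ∎)
  where
  open ≡-Reasoning
  y = m + n ∸ o
  y+o≡m+n : y + o ≡ m + n
  y+o≡m+n = m∸n+n≡m (≮⇒≥ m+n≮o)
  y<o : y < o
  y<o = +-cancelʳ-< o y o (subst (_< o + o) (sym y+o≡m+n) (+-mono-<-≤ m<o n≤o))

m≢[m+n]%o : ∀ {m n o} .{{_ : NonZero o}} → m < o → 0 < n → n < o → m ≢ (m + n) % o
m≢[m+n]%o {m} {n} {o} m<o 0<n n<o eq with [m+n]%o≡m+n∨[m+n]%o+o≡m+n m n o m<o (<⇒≤ n<o)
... | inj₁ e = <⇒≢ 0<n (+-cancelˡ-≡ m 0 n (trans (+-identityʳ m) (trans eq e)))
... | inj₂ e = <⇒≢ n<o (sym (+-cancelˡ-≡ m o n (trans (cong (_+ o) eq) e)))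

m%o≢[m+n]%o : ∀ m n o .{{_ : NonZero o}} → 0 < n → n < o → m % o ≢ (m + n) % o
m%o≢[m+n]%o m n o 0<n n<o eq =
  m≢[m+n]%o (m%n<n m o) 0<n n<o (trans eq ([m+n]%o≡[m%o+n]%o m n o))

m%o≡[m+n]%o⇒n≡0 : ∀ m {n o} .{{_ : NonZero o}} → n < o → m % o ≡ (m + n) % o → n ≡ 0
m%o≡[m+n]%o⇒n≡0 m {zero}  _   _  = refl
m%o≡[m+n]%o⇒n≡0 m {suc n} {o} n<o eq = contradiction eq (m%o≢[m+n]%o m (suc n) o z<s n<o)

m≤n<m+o∧m%o≡n%o⇒m≡n : ∀ {m n o} .{{_ : NonZero o}} → m ≤ n → n < m + o →
  m % o ≡ n % o → m ≡ n
m≤n<m+o∧m%o≡n%o⇒m≡n {m} {n} {o} m≤n n<m+o eq = begin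
  m            ≡⟨ +-identityʳ m ⟨
  m + 0        ≡⟨ cong (m +_) n∸m≡0 ⟨
  m + (n ∸ m)  ≡⟨ m+[n∸m]≡n m≤n ⟩
  n            ∎
  where
  open ≡-Reasoning
  n∸m<o : n ∸ m < o
  n∸m<o = +-cancelˡ-< m (n ∸ m) o (subst (_< m + o) (sym (m+[n∸m]≡n m≤n)) n<m+o)
  n∸m≡0 : n ∸ m ≡ 0
  n∸m≡0 = m%o≡[m+n]%o⇒n≡0 m n∸m<o (trans eq (cong (_% o) (sym (m+[n∸m]≡n m≤n))))

m%o≡n%o⇒m≡n : ∀ {a m n o} .{{_ : NonZero o}} → a ≤ m → a ≤ n → m < a + o → n < a + o →
  m % o ≡ n % o → m ≡ n
m%o≡n%o⇒m≡n {a} {m} {n} {o} a≤m a≤n m<a+o n<a+o eq with ≤-total m n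
... | inj₁ m≤n = m≤n<m+o∧m%o≡n%o⇒m≡n m≤n (<-≤-trans n<a+o (+-monoˡ-≤ o a≤m)) eq
... | inj₂ n≤m = sym (m≤n<m+o∧m%o≡n%o⇒m≡n n≤m (<-≤-trans m<a+o (+-monoˡ-≤ o a≤n)) (sym eq))

∣m-[m+n]%o∣<r∨o∸r<∣m-[m+n]%o∣ : ∀ {m n o r} .{{_ : NonZero o}} → m < o → n < r → r ≤ o →
  ∣ m - (m + n) % o ∣ < r ⊎ o ∸ r < ∣ m - (m + n) % o ∣
∣m-[m+n]%o∣<r∨o∸r<∣m-[m+n]%o∣ {m} {n} {o} {r} m<o n<r r≤o
  with (m + n) % o | [m+n]%o≡m+n∨[m+n]%o+o≡m+n m n o m<o (≤-trans (<⇒≤ n<r) r≤o)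
... | y | inj₁ refl = inj₁ (subst (_< r) (sym ∣m-[m+n]∣≡n) n<r)
  where
  ∣m-[m+n]∣≡n : ∣ m - (m + n) ∣ ≡ n
  ∣m-[m+n]∣≡n = trans (m≤n⇒∣m-n∣≡n∸m (m≤m+n m n)) (m+n∸m≡n m n)
... | y | inj₂ y+o≡m+n = inj₂ (subst (o ∸ r <_) (sym ∣m-y∣≡o∸n) (∸-monoʳ-< n<r r≤o))
  where
  open ≡-Reasoning
  y≤m : y ≤ m
  y≤m = +-cancelʳ-≤ o y m
    (subst (_≤ m + o) (sym y+o≡m+n) (+-monoʳ-≤ m (≤-trans (<⇒≤ n<r) r≤o)))
  ∣m-y∣≡o∸n : ∣ m - y ∣ ≡ o ∸ n
  ∣m-y∣≡o∸n = begin
    ∣ m - y ∣              ≡⟨ m≤n⇒∣n-m∣≡n∸m y≤m ⟩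
    m ∸ y                  ≡⟨ [m+n]∸[m+o]≡n∸o n m y ⟨
    (n + m) ∸ (n + y)      ≡⟨ cong₂ _∸_ (trans (+-comm n m) (sym y+o≡m+n)) (+-comm n y) ⟩
    (y + o) ∸ (y + n)      ≡⟨ [m+n]∸[m+o]≡n∸o y o n ⟩
    o ∸ n                  ∎

[m*n+o]/n≡m : ∀ m {n o} .{{_ : NonZero n}} → o < n → (m * n + o) / n ≡ m
[m*n+o]/n≡m m {n} {o} o<n = begin
  (m * n + o) / n      ≡⟨ +-distrib-/-∣ˡ o (n∣m*n m) ⟩
  m * n / n + o / n    ≡⟨ cong₂ _+_ (m*n/n≡m m n) (m<n⇒m/n≡0 o<n) ⟩
  m + 0                ≡⟨ +-identityʳ m ⟩
  m                    ∎
  where open ≡-Reasoning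

n<m⇒2≤⌈m/n⌉ : ∀ {m n} .{{_ : NonZero n}} → n < m → 2 ≤ ⌈ m / n ⌉
n<m⇒2≤⌈m/n⌉ {m} {suc n} n<m = begin
  2                        ≡⟨ m*n/n≡m 2 (suc n) ⟨
  2 * suc n / suc n        ≤⟨ /-monoˡ-≤ (suc n) (≤-reflexive 2[1+n]≡2+n+n) ⟩
  (2 + n + n) / suc n      ≤⟨ /-monoˡ-≤ (suc n) (+-monoˡ-≤ n n<m) ⟩
  (m + n) / suc n          ∎
  where
  open ≤-Reasoning
  2[1+n]≡2+n+n : 2 * suc n ≡ 2 + n + n
  2[1+n]≡2+n+n = cong suc (trans (cong (n +_) (+-identityʳ (suc n))) (+-suc n n))

rank : ∀ {n} (S : Subset n) (x : Fin n) → x ∈ S → Fin ∣ S ∣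
rank (inside  ∷ S) zero    here      = zero
rank (inside  ∷ S) (suc x) (there p) = suc (rank S x p)
rank (outside ∷ S) (suc x) (there p) = rank S x p

rank-injective : ∀ {n} (S : Subset n) {x y} (p : x ∈ S) (q : y ∈ S) →
  rank S x p ≡ rank S y q → x ≡ y
rank-injective (inside  ∷ S) here      here      _  = refl
rank-injective (inside  ∷ S) (there p) (there q) eq =
  cong suc (rank-injective S p q (suc-injective eq))
rank-injective (outside ∷ S) (there p) (there q) eq = cong suc (rank-injective S p q eq)

∣p∪q∣≤∣p∣+∣q∣ : ∀ {n} (p q : Subset n) → ∣ p ∪ q ∣ ≤ ∣ p ∣ + ∣ q ∣
∣p∪q∣≤∣p∣+∣q∣ []            []            = z≤n
∣p∪q∣≤∣p∣+∣q∣ (inside  ∷ p) (inside  ∷ q) =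
  s≤s (≤-trans (∣p∪q∣≤∣p∣+∣q∣ p q) (subst (∣ p ∣ + ∣ q ∣ ≤_) (sym (+-suc ∣ p ∣ ∣ q ∣)) (n≤1+n _)))
∣p∪q∣≤∣p∣+∣q∣ (inside  ∷ p) (outside ∷ q) = s≤s (∣p∪q∣≤∣p∣+∣q∣ p q)
∣p∪q∣≤∣p∣+∣q∣ (outside ∷ p) (inside  ∷ q) =
  subst (∣ p ∪ q ∣ <_) (sym (+-suc ∣ p ∣ ∣ q ∣)) (s≤s (∣p∪q∣≤∣p∣+∣q∣ p q))
∣p∪q∣≤∣p∣+∣q∣ (outside ∷ p) (outside ∷ q) = ∣p∪q∣≤∣p∣+∣q∣ p q

module PowerOfPath {m r : ℕ} (c : (t : ℕ) → .(t ≤ m) → Fin r)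
  (proper : ∀ {t t'} .(p : t ≤ m) .(p' : t' ≤ m) → t < t' → t' < t + r → c t p ≢ c t' p')
  where

  c-cong : ∀ {t t'} → t ≡ t' → .(p : t ≤ m) .(p' : t' ≤ m) → c t p ≡ c t' p'
  c-cong refl _ _ = refl

  -- Two of the r + 1 colours at s, …, s + r agree, and properness leaves only s and s + r.
  colour-+r : ∀ s (p : r + s ≤ m) → c s (≤-trans (m≤n+m s r) p) ≡ c (r + s) p
  colour-+r s p with pigeonhole (n<1+n r) (λ i → c (s + toℕ i) (at i))
    where
    at : (i : Fin (suc r)) → s + toℕ i ≤ m
    at i = ≤-trans (+-monoʳ-≤ s (s≤s⁻¹ (toℕ<n i))) (≤-trans (≤-reflexive (+-comm s r)) p)
  ... | i , j , i<j , cᵢ≡cⱼ with toℕ j <? toℕ i + r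
  ...   | yes j<i+r = ⊥-elim (proper _ _ (+-monoʳ-< s i<j)
    (subst (s + toℕ j <_) (sym (+-assoc s (toℕ i) r)) (+-monoʳ-< s j<i+r)) cᵢ≡cⱼ)
  ...   | no  j≮i+r = begin
    c s _              ≡⟨ c-cong (sym (trans (cong (s +_) i≡0) (+-identityʳ s))) _ _ ⟩
    c (s + toℕ i) _    ≡⟨ cᵢ≡cⱼ ⟩
    c (s + toℕ j) _    ≡⟨ c-cong (trans (cong (s +_) j≡r) (+-comm s r)) _ _ ⟩
    c (r + s) _        ∎
    where
    open ≡-Reasoning
    i+r≤j : toℕ i + r ≤ toℕ j
    i+r≤j = ≮⇒≥ j≮i+r
    j≡r : toℕ j ≡ r
    j≡r = ≤-antisym (s≤s⁻¹ (toℕ<n j)) (≤-trans (m≤n+m r (toℕ i)) i+r≤j)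
    i≡0 : toℕ i ≡ 0
    i≡0 = n≤0⇒n≡0 (+-cancelʳ-≤ r (toℕ i) 0 (≤-trans i+r≤j (≤-reflexive j≡r)))

  colour-periodic : ∀ q (p : q * r ≤ m) → c (q * r) p ≡ c 0 z≤n
  colour-periodic zero    _ = refl
  colour-periodic (suc q) p =
    trans (sym (colour-+r (q * r) p)) (colour-periodic q (≤-trans (m≤n+m (q * r) r) p))

end : ∀ {n} (F : Graph n) → Edge F → Fin 2 → Fin n
end F e zero       = lo F e
end F e (suc zero) = hi F e

end-injective : ∀ {n} (F : Graph n) (e : Edge F) {b b'} → end F e b ≡ end F e b' → b ≡ b'
end-injective F e                   {zero}     {zero}     _  = refl
end-injective F (_ , _ , lo<hi , _) {zero}     {suc zero} eq =
  ⊥-elim (<-irrefl (cong toℕ eq) lo<hi)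
end-injective F (_ , _ , lo<hi , _) {suc zero} {zero}     eq =
  ⊥-elim (<-irrefl (cong toℕ (sym eq)) lo<hi)
end-injective F e                   {suc zero} {suc zero} _  = refl

disjoint⇒end≢end : ∀ {n} (F : Graph n) {e f} → Disjoint F e f → ∀ b b' → end F e b ≢ end F f b'
disjoint⇒end≢end F (ll , _  , _  , _ ) zero       zero       = ll
disjoint⇒end≢end F (_  , lh , _  , _ ) zero       (suc zero) = lh
disjoint⇒end≢end F (_  , _  , hl , _ ) (suc zero) zero       = hl
disjoint⇒end≢end F (_  , _  , _  , hh) (suc zero) (suc zero) = hh

module _ {n} (F : Graph n) {m} (es : Fin m → Edge F)
  (disjoint : ∀ a b → a ≢ b → Disjoint F (es a) (es b)) where

  endpoint : Fin m → Fin 2 → Fin n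
  endpoint a = end F (es a)

  endpoint-injective : ∀ {a b a' b'} → endpoint a b ≡ endpoint a' b' → a ≡ a' × b ≡ b'
  endpoint-injective {a} {b} {a'} {b'} eq with a Fin.≟ a'
  ... | yes refl = refl , end-injective F (es a) eq
  ... | no  a≢a' = ⊥-elim (disjoint⇒end≢end F (disjoint a a' a≢a') b b' eq)

  endpoints-in-image⇒m*2≤s : ∀ {s} (g : Fin s → Fin n) → (∀ a b → ∃ λ k → endpoint a b ≡ g k) →
    m * 2 ≤ s
  endpoints-in-image⇒m*2≤s {s} g covered = injective⇒≤ index-injective
    where
    index : Fin (m * 2) → Fin s
    index i = proj₁ (uncurry covered (remQuot {m} 2 i))
    index-injective : Injective _≡_ _≡_ index
    index-injective {i} {j} eq = begin
      i                              ≡⟨ combine-remQuot {m} 2 i ⟨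
      uncurry combine (remQuot {m} 2 i)  ≡⟨ cong (uncurry combine) remQuot-i≡remQuot-j ⟩
      uncurry combine (remQuot {m} 2 j)  ≡⟨ combine-remQuot {m} 2 j ⟩
      j                              ∎
      where
      open ≡-Reasoning
      same-endpoint : uncurry endpoint (remQuot {m} 2 i) ≡ uncurry endpoint (remQuot {m} 2 j)
      same-endpoint = trans (proj₂ (uncurry covered (remQuot {m} 2 i)))
        (trans (cong g eq) (sym (proj₂ (uncurry covered (remQuot {m} 2 j)))))
      remQuot-i≡remQuot-j : remQuot {m} 2 i ≡ remQuot {m} 2 j
      remQuot-i≡remQuot-j with endpoint-injective same-endpoint
      ... | a≡a' , b≡b' = cong₂ _,_ a≡a' b≡b'

module Construction (r₀ l₀ : ℕ) where
  r l L R N : ℕ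
  r = 2 + r₀
  l = 1 + l₀
  L = l * r
  R = 2 * r ∸ 1
  N = L * R

  1+R≡r*2 : suc R ≡ r * 2
  1+R≡r*2 = trans (suc-pred (2 * r)) (*-comm 2 r)

  r≤L : r ≤ L
  r≤L = m≤m+n r (l₀ * r)

  R<r*2 : R < r * 2
  R<r*2 = subst (R <_) 1+R≡r*2 (n<1+n R)

  2≤R : 2 ≤ R
  2≤R = ≤-trans (n≤1+n 2) (s≤s⁻¹ (subst (4 ≤_) (sym 1+R≡r*2) (*-monoˡ-≤ 2 {2} {r} (s≤s (s≤s z≤n)))))

  L+L≤N : L + L ≤ N
  L+L≤N = subst (_≤ N) (trans (*-comm L 2) (cong (L +_) (+-identityʳ L))) (*-monoʳ-≤ L 2≤R)

  L<N : L < N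
  L<N = <-≤-trans (m<m+n L z<s) L+L≤N

  r≤N : r ≤ N
  r≤N = ≤-trans r≤L (<⇒≤ L<N)

  L≤N∸r : L ≤ N ∸ r
  L≤N∸r = subst (_≤ N ∸ r) (m+n∸n≡m L r) (∸-monoˡ-≤ r (≤-trans (+-monoʳ-≤ L r≤L) L+L≤N))

  vertex : ℕ → Fin N
  vertex a = a mod N

  toℕ-vertex : ∀ a → toℕ (vertex a) ≡ a % N
  toℕ-vertex a = toℕ-fromℕ< (m%n<n a N)

  toℕ-vertex-< : ∀ {a} → a < N → toℕ (vertex a) ≡ a
  toℕ-vertex-< {a} a<N = trans (toℕ-vertex a) (m<n⇒m%n≡m a<N)

  vertex-≢ : ∀ a {d} → 0 < d → d < N → vertex a ≢ vertex (a + d)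
  vertex-≢ a {d} 0<d d<N eq = m%o≢[m+n]%o a d N 0<d d<N
    (trans (sym (toℕ-vertex a)) (trans (cong toℕ eq) (toℕ-vertex (a + d))))

  Band : Fin N → Fin N → Set
  Band u v = Σ ℕ λ a → Σ ℕ λ d → 0 < d × d < r × u ≡ vertex a × v ≡ vertex (a + d)

  CycleEdge : Fin N → Fin N → Set
  CycleEdge u v = Σ ℕ λ k → k < R × u ≡ vertex (k * L) × v ≡ vertex (k * L + L)

  Either : (Fin N → Fin N → Set) → Fin N → Fin N → Set
  Either E u v = E u v ⊎ E v u

  band-irrefl : ∀ {u} → ¬ Band u u
  band-irrefl (a , d , 0<d , d<r , refl , eq) = vertex-≢ a 0<d (<-≤-trans d<r r≤N) eq

  cycleEdge-irrefl : ∀ {u} → ¬ CycleEdge u u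
  cycleEdge-irrefl (k , _ , refl , eq) = vertex-≢ (k * L) z<s L<N eq

  F : Graph N
  F = record
    { Adj    = λ u v → Either Band u v ⊎ Either CycleEdge u v
    ; sym    = Sum.map Sum.swap Sum.swap
    ; irrefl = [ [ band-irrefl , band-irrefl ] , [ cycleEdge-irrefl , cycleEdge-irrefl ] ]
    }

  -- For two points of [0, N) at distance δ, their cyclic distance is below r.
  Short : ℕ → Set
  Short δ = δ < r ⊎ N ∸ r < δ

  band-short : ∀ {u v} → Band u v → Short ∣ toℕ u - toℕ v ∣
  band-short (a , d , _ , d<r , refl , refl) = subst₂ (λ x y → Short ∣ x - y ∣)
    (sym (toℕ-vertex a)) (sym (trans (toℕ-vertex (a + d)) ([m+n]%o≡[m%o+n]%o a d N)))
    (∣m-[m+n]%o∣<r∨o∸r<∣m-[m+n]%o∣ (m%n<n a N) d<r r≤N)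

  short-unstable : (e : Edge F) → Short ∣ toℕ (lo F e) - toℕ (hi F e) ∣ → ¬ Stable {F = F} r e
  short-unstable (i , j , i<j , _) short (r≤j-i , j-i≤N∸r)
    with subst Short (m≤n⇒∣m-n∣≡n∸m (<⇒≤ i<j)) short
  ... | inj₁ j-i<r   = <⇒≱ j-i<r r≤j-i
  ... | inj₂ N∸r<j-i = <⇒≱ N∸r<j-i j-i≤N∸r

  corner : Fin R → Fin N
  corner k = vertex (toℕ k * L)

  IsCorner : Fin N → Set
  IsCorner u = ∃ λ k → u ≡ corner k

  vertex-corner : ∀ {k} → k < R → IsCorner (vertex (k * L))
  vertex-corner k<R = fromℕ< k<R , cong (λ k → vertex (k * L)) (sym (toℕ-fromℕ< k<R))

  cycleEdge-corners : ∀ {u v} → CycleEdge u v → IsCorner u × IsCorner v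
  cycleEdge-corners (k , k<R , refl , refl) = vertex-corner k<R , next-corner
    where
    next-corner : IsCorner (vertex (k * L + L))
    next-corner with suc k <? R
    ... | yes 1+k<R = subst IsCorner (cong vertex (+-comm L (k * L))) (vertex-corner 1+k<R)
    ... | no  1+k≮R = zero , fromℕ<-cong ((k * L + L) % N) 0 {N} N%N≡0 _ (m%n<n 0 N)
      where
      kL+L≡N : k * L + L ≡ N
      kL+L≡N = trans (+-comm (k * L) L)
        (trans (cong (_* L) (≤-antisym k<R (≮⇒≥ 1+k≮R))) (*-comm R L))
      N%N≡0 : (k * L + L) % N ≡ 0
      N%N≡0 = trans (cong (_% N) kL+L≡N) (n%n≡0 N)

  stable-corners : (e : Edge F) → Stable {F = F} r e → IsCorner (lo F e) × IsCorner (hi F e)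
  stable-corners e@(_ , _ , _ , inj₁ (inj₁ b)) st = ⊥-elim (short-unstable e (band-short b) st)
  stable-corners e@(i , j , _ , inj₁ (inj₂ b)) st =
    ⊥-elim (short-unstable e (subst Short (∣-∣-comm (toℕ j) (toℕ i)) (band-short b)) st)
  stable-corners (_ , _ , _ , inj₂ (inj₁ c)) _ = cycleEdge-corners c
  stable-corners (_ , _ , _ , inj₂ (inj₂ c)) _ = swap (cycleEdge-corners c)

  no-KGEdge : ¬ KGEdge F r
  no-KGEdge (es , disjoint) =
    <⇒≱ R<r*2 (endpoints-in-image⇒m*2≤s F (proj₁ ∘ es) disjoint corner on-corner)
    where
    on-corner : ∀ a b → IsCorner (end F (proj₁ (es a)) b)
    on-corner a zero       = proj₁ (stable-corners (proj₁ (es a)) (proj₂ (es a)))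
    on-corner a (suc zero) = proj₂ (stable-corners (proj₁ (es a)) (proj₂ (es a)))

  cycleEdge₀ : StableEdge F r
  cycleEdge₀ =
    (vertex 0 , vertex L , 0<L , inj₂ (inj₁ (0 , <-≤-trans z<s 2≤R , refl , refl))) , r≤L′ , L≤N∸r′
    where
    toℕL : toℕ (vertex L) ≡ L
    toℕL = toℕ-vertex-< L<N
    0<L : toℕ (vertex 0) < toℕ (vertex L)
    0<L = subst (0 <_) (sym toℕL) z<s
    r≤L′ : r ≤ toℕ (vertex L) ∸ toℕ (vertex 0)
    r≤L′ = subst (r ≤_) (sym toℕL) r≤L
    L≤N∸r′ : toℕ (vertex L) ∸ toℕ (vertex 0) ≤ N ∸ r
    L≤N∸r′ = subst (_≤ N ∸ r) (sym toℕL) L≤N∸r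

  χ≡1 : KGChromaticNumber F r 1
  χ≡1 = ((λ _ → zero) , λ h _ → no-KGEdge h) ,
        λ { zero _ (c , _) → ¬Fin0 (c cycleEdge₀) ; (suc _) (s≤s ()) }

  residue : Fin N → Fin r
  residue v = toℕ v mod r

  residue-band : ∀ {u v} → Band u v → residue u ≢ residue v
  residue-band (a , d , 0<d , d<r , refl , refl) eq = m%o≢[m+n]%o a d r 0<d d<r (begin
    a % r                           ≡⟨ m∣n⇒o%n%m≡o%m r N a r∣N ⟨
    a % N % r                       ≡⟨ cong (_% r) (toℕ-vertex a) ⟨
    toℕ (vertex a) % r              ≡⟨ toℕ-fromℕ< (m%n<n (toℕ (vertex a)) r) ⟨
    toℕ (residue (vertex a))        ≡⟨ cong toℕ eq ⟩
    toℕ (residue (vertex (a + d)))  ≡⟨ toℕ-fromℕ< (m%n<n (toℕ (vertex (a + d))) r) ⟩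
    toℕ (vertex (a + d)) % r        ≡⟨ cong (_% r) (toℕ-vertex (a + d)) ⟩
    (a + d) % N % r                 ≡⟨ m∣n⇒o%n%m≡o%m r N (a + d) r∣N ⟩
    (a + d) % r                     ∎)
    where
    open ≡-Reasoning
    r∣N = n∣m*n*o l R

  even⊎odd : ∀ k → ∃ λ j → k ≡ j * 2 ⊎ k ≡ suc (j * 2)
  even⊎odd zero = 0 , inj₁ refl
  even⊎odd (suc k) with even⊎odd k
  ... | j , inj₁ refl = j , inj₂ refl
  ... | j , inj₂ refl = suc j , inj₁ refl

  evenCorners : ℕ → Subset N
  evenCorners zero    = ∅
  evenCorners (suc j) = ⁅ vertex (j * 2 * L) ⁆ ∪ evenCorners j

  ∈-evenCorners : ∀ {j i} → j < i → vertex (j * 2 * L) ∈ evenCorners i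
  ∈-evenCorners {j} {suc i} j<1+i with j ≟ i
  ... | yes refl = p⊆p∪q (evenCorners i) (x∈⁅x⁆ (vertex (j * 2 * L)))
  ... | no  j≢i  =
    q⊆p∪q ⁅ vertex (i * 2 * L) ⁆ (evenCorners i) (∈-evenCorners (≤∧≢⇒< (s≤s⁻¹ j<1+i) j≢i))

  ∣evenCorners∣≤ : ∀ i → ∣ evenCorners i ∣ ≤ i
  ∣evenCorners∣≤ zero    = ≤-reflexive (∣⊥∣≡0 N)
  ∣evenCorners∣≤ (suc i) = begin
    ∣ ⁅ x ⁆ ∪ evenCorners i ∣          ≤⟨ ∣p∪q∣≤∣p∣+∣q∣ ⁅ x ⁆ (evenCorners i) ⟩
    ∣ ⁅ x ⁆ ∣ + ∣ evenCorners i ∣      ≡⟨ cong (_+ ∣ evenCorners i ∣) (∣⁅x⁆∣≡1 x) ⟩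
    suc ∣ evenCorners i ∣              ≤⟨ s≤s (∣evenCorners∣≤ i) ⟩
    suc i                              ∎
    where
    open ≤-Reasoning
    x = vertex (i * 2 * L)

  S₀ : Subset N
  S₀ = evenCorners r

  -- R = 2r - 1 is odd, so of two consecutive corners one has an even index below R.
  cycleEdge-meets-S₀ : ∀ {u v} → CycleEdge u v → u ∈ S₀ ⊎ v ∈ S₀
  cycleEdge-meets-S₀ (k , k<R , refl , refl) with even⊎odd k
  ... | j , inj₁ refl = inj₁ (∈-evenCorners (*-cancelʳ-< 2 j r (<-trans k<R R<r*2)))
  ... | j , inj₂ refl = inj₂ (subst (_∈ S₀) (cong vertex (+-comm L (suc (j * 2) * L)))
                               (∈-evenCorners (*-cancelʳ-< 2 (suc j) r (≤-<-trans k<R R<r*2))))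

  S₀-colourable : ColourableOutside F r S₀
  S₀-colourable = (λ v _ → residue v) , proper
    where
    proper : ∀ u v (u∉S₀ : u ∉ S₀) (v∉S₀ : v ∉ S₀) → Adj F u v → residue u ≢ residue v
    proper u v _   _   (inj₁ (inj₁ b)) = residue-band b
    proper u v _   _   (inj₁ (inj₂ b)) = residue-band b ∘ sym
    proper u v u∉ v∉ (inj₂ (inj₁ c)) _ = [ u∉ , v∉ ] (cycleEdge-meets-S₀ c)
    proper u v u∉ v∉ (inj₂ (inj₂ c)) _ = [ v∉ , u∉ ] (cycleEdge-meets-S₀ c)

  arcPoint : ℕ → ℕ → Fin N
  arcPoint k t = vertex (k * L + t)

  ArcAvoids ArcMeets : Subset N → ℕ → Set
  ArcAvoids S k = ∀ (t : Fin (suc L)) → arcPoint k (toℕ t) ∉ S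
  ArcMeets  S k = ∃ λ (t : Fin (suc L)) → arcPoint k (toℕ t) ∈ S

  arcPoint-band : ∀ k {t t'} → t < t' → t' < t + r → Band (arcPoint k t) (arcPoint k t')
  arcPoint-band k {t} {t'} t<t' t'<t+r =
    k * L + t , t' ∸ t , m<n⇒0<n∸m t<t' , t'∸t<r , refl , cong vertex kL+t'≡kL+t+[t'∸t]
    where
    t'∸t<r : t' ∸ t < r
    t'∸t<r = +-cancelˡ-< t (t' ∸ t) r (subst (_< t + r) (sym (m+[n∸m]≡n (<⇒≤ t<t'))) t'<t+r)
    kL+t'≡kL+t+[t'∸t] : k * L + t' ≡ k * L + t + (t' ∸ t)
    kL+t'≡kL+t+[t'∸t] =
      trans (cong (k * L +_) (sym (m+[n∸m]≡n (<⇒≤ t<t')))) (sym (+-assoc (k * L) t (t' ∸ t)))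

  avoided-arc⇒¬colourable : ∀ S {k} → k < R → ArcAvoids S k → ¬ ColourableOutside F r S
  avoided-arc⇒¬colourable S {k} k<R avoids (c , proper) =
    proper (arcPoint k 0) (arcPoint k L) _ _
      (inj₂ (inj₁ (k , k<R , cong vertex (+-identityʳ (k * L)) , refl)))
      (sym (PowerOfPath.colour-periodic colour proper-on-arc l ≤-refl))
    where
    avoids′ : ∀ t → t ≤ L → arcPoint k t ∉ S
    avoids′ t t≤L =
      subst (λ t → arcPoint k t ∉ S) (toℕ-fromℕ< (s≤s t≤L)) (avoids (fromℕ< (s≤s t≤L)))
    colour : (t : ℕ) → .(t ≤ L) → Fin r
    colour t t≤L = c (arcPoint k t) (avoids′ t (recompute (t ≤? L) t≤L))
    proper-on-arc : ∀ {t t'} .(p : t ≤ L) .(p' : t' ≤ L) → t < t' → t' < t + r →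
      colour t p ≢ colour t' p'
    proper-on-arc _ _ t<t' t'<t+r = proper _ _ _ _ (inj₁ (inj₁ (arcPoint-band k t<t' t'<t+r)))

  kL+L≤N : ∀ {k} → k < R → k * L + L ≤ N
  kL+L≤N {k} k<R = subst₂ _≤_ (+-comm L (k * L)) (*-comm R L) (*-monoˡ-≤ L k<R)

  arcPoint-injective-< : ∀ {k k' t t'} → k < R → k' < R → t < L → t' < L →
    arcPoint k t ≡ arcPoint k' t' → k ≡ k'
  arcPoint-injective-< {k} {k'} {t} {t'} k<R k'<R t<L t'<L eq = begin
    k                  ≡⟨ [m*n+o]/n≡m k t<L ⟨
    (k * L + t) / L    ≡⟨ cong (_/ L) kL+t≡k'L+t' ⟩
    (k' * L + t') / L  ≡⟨ [m*n+o]/n≡m k' t'<L ⟩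
    k'                 ∎
    where
    open ≡-Reasoning
    kL+t≡k'L+t' : k * L + t ≡ k' * L + t'
    kL+t≡k'L+t' = trans (sym (toℕ-vertex-< (<-≤-trans (+-monoʳ-< (k * L) t<L) (kL+L≤N k<R))))
      (trans (cong toℕ eq) (toℕ-vertex-< (<-≤-trans (+-monoʳ-< (k' * L) t'<L) (kL+L≤N k'<R))))

  arcEnd-injective : ∀ {k k'} → k < R → k' < R → arcPoint k L ≡ arcPoint k' L → k ≡ k'
  arcEnd-injective {k} {k'} k<R k'<R eq = *-cancelʳ-≡ k k' L (+-cancelʳ-≡ L (k * L) (k' * L)
    (m%o≡n%o⇒m≡n (m≤n+m L (k * L)) (m≤n+m L (k' * L)) (<L+N k<R) (<L+N k'<R)
      (trans (sym (toℕ-vertex (k * L + L))) (trans (cong toℕ eq) (toℕ-vertex (k' * L + L))))))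
    where
    <L+N : ∀ {k} → k < R → k * L + L < L + N
    <L+N k<R = ≤-<-trans (kL+L≤N k<R) (m<n+m N {L} z<s)

  endFlag : ∀ {t} → Dec (t < L) → Fin 2
  endFlag (yes _) = zero
  endFlag (no  _) = suc zero

  arcPoint-injective : ∀ {k k' t t'} → k < R → k' < R → t ≤ L → t' ≤ L →
    (t<L? : Dec (t < L)) (t'<L? : Dec (t' < L)) → endFlag t<L? ≡ endFlag t'<L? →
    arcPoint k t ≡ arcPoint k' t' → k ≡ k'
  arcPoint-injective k<R k'<R _ _ (yes t<L) (yes t'<L) _ = arcPoint-injective-< k<R k'<R t<L t'<L
  arcPoint-injective {k} {k'} k<R k'<R t≤L t'≤L (no t≮L) (no t'≮L) _ =
    arcEnd-injective k<R k'<R ∘ subst₂ (λ t t' → arcPoint k t ≡ arcPoint k' t')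
      (≤-antisym t≤L (≮⇒≥ t≮L)) (≤-antisym t'≤L (≮⇒≥ t'≮L))

  -- A vertex lies on at most two arcs, as the end of one and the start of the next; the
  -- flag says which, so the code is injective.
  meets-every-arc⇒R≤∣S∣*2 : ∀ S → (∀ (k : Fin R) → ArcMeets S (toℕ k)) → R ≤ ∣ S ∣ * 2
  meets-every-arc⇒R≤∣S∣*2 S meets = injective⇒≤ code-injective
    where
    position : Fin R → ℕ
    position k = toℕ (proj₁ (meets k))
    position≤L : ∀ k → position k ≤ L
    position≤L k = s≤s⁻¹ (toℕ<n (proj₁ (meets k)))
    code : Fin R → Fin (∣ S ∣ * 2)
    code k = combine (rank S _ (proj₂ (meets k))) (endFlag (position k <? L))
    code-injective : Injective _≡_ _≡_ code
    code-injective {k} {k'} eq = toℕ-injective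
      (arcPoint-injective (toℕ<n k) (toℕ<n k') (position≤L k) (position≤L k')
        (position k <? L) (position k' <? L) (combine-injectiveʳ {∣ S ∣} _ _ _ _ eq)
        (rank-injective S _ _ (combine-injectiveˡ {∣ S ∣} _ _ _ _ eq)))

  R≤s*2⇒r≤s : ∀ {s} → R ≤ s * 2 → r ≤ s
  R≤s*2⇒r≤s {s} R≤s*2 =
    s≤s⁻¹ (*-cancelʳ-< 2 r (suc s) (subst (_< suc s * 2) 1+R≡r*2 (s≤s (s≤s R≤s*2))))

  colourable⇒r≤∣S∣ : ∀ S → ColourableOutside F r S → r ≤ ∣ S ∣
  colourable⇒r≤∣S∣ S colourable
    with any? (λ (k : Fin R) → all? (λ (t : Fin (suc L)) → ¬? (arcPoint (toℕ k) (toℕ t) ∈? S)))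
  ... | yes (k , avoids) = ⊥-elim (avoided-arc⇒¬colourable S (toℕ<n k) avoids colourable)
  ... | no  ¬avoided     = R≤s*2⇒r≤s (meets-every-arc⇒R≤∣S∣*2 S meets)
    where
    meets : ∀ (k : Fin R) → ArcMeets S (toℕ k)
    meets k with any? (λ (t : Fin (suc L)) → arcPoint (toℕ k) (toℕ t) ∈? S)
    ... | yes hit = hit
    ... | no  ¬hit = ⊥-elim (¬avoided (k , λ t t∈S → ¬hit (t , t∈S)))

  cd≡∣S₀∣ : ColourabilityDefect F r ∣ S₀ ∣
  cd≡∣S₀∣ = (S₀ , refl , S₀-colourable) ,
            λ S colourable → ≤-trans (∣evenCorners∣≤ r) (colourable⇒r≤∣S∣ S colourable)

  2≤⌈∣S₀∣/[r-1]⌉ : 2 ≤ ⌈ ∣ S₀ ∣ / (r ∸ 1) ⌉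
  2≤⌈∣S₀∣/[r-1]⌉ = n<m⇒2≤⌈m/n⌉ (colourable⇒r≤∣S∣ S₀ S₀-colourable)

theorem2p6 : (r l : ℕ) → 2 ≤ r → 1 ≤ l →
    Σ (Graph (l * r * (2 * r ∸ 1))) λ F →
      KGChromaticNumber F r 1 ×
      Σ ℕ λ d → ColourabilityDefect F r d × (2 ≤ ⌈ d / (r ∸ 1) ⌉)
theorem2p6 (suc (suc r₀)) (suc l₀) (s≤s (s≤s z≤n)) (s≤s z≤n) =
  F , χ≡1 , ∣ S₀ ∣ , cd≡∣S₀∣ , 2≤⌈∣S₀∣/[r-1]⌉
  where open Construction r₀ l₀
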